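{- Call a finite word $w$ over $\{U,D\}$ (where $U=(1,1)$, $D=(1,-1)$) an admissible path if the lattice path it describes, starting at $(0,0)$, never goes below the $x$-axis and every maximal run of consecutive $D$-steps that ends on the $x$-axis has odd length. For an admissible path ending with a $D$-step, the current down-run is the maximal run of $D$-steps that contains the last step, and its starting level is the level at which that run begins. Let $r_2=r_2(z)=\frac{1-\sqrt{1-4z^2}}{2z}$. Define the generating functions (with $z$ marking the number of steps): $f_j$ ($j\ge1$): admissible paths ending with a $D$-step at level $j$ whose current down-run has even starting level; $h_j$ ($j\ge0$): admissible paths ending with a $D$-step at level $j$ whose current down-run has odd starting level; $g_j$ ($j\ge0$): admissible paths ending at level $j$ whose last step is $U$, together with the empty path when $j=0$. Then $g_0=1$, $g_j=r_2^j-z^2r_2^{j+2}$ for $j\ge1$, $f_j=z\,r_2^{j+1}$ if $j$ is odd and $f_j=z^2r_2^{j+2}$ if $j$ is even, and $h_j=z\,r_2^{j+1}$ if $j$ is even and $h_j=z^2r_2^{j+2}$ if $j$ is odd.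
   Context: Admissible paths are exactly the prefixes of Stanley's restricted Dyck paths (Dyck paths in which every maximal run of down-steps ending on the $x$-axis has odd length). A run of $D$-steps at the end of the word is maximal if it cannot be extended to the left. Each nonempty admissible path falls into exactly one of the classes counted by $f_j$, $g_j$, $h_j$ according to its last step and final level $j$. -}

module Defs where

open import Data.Nat using (ℕ; zero; suc; _+_; _*_; _∸_; _≤_; _/_; _%_)
open import Data.Nat.Combinatorics using (_C_)
open import Data.Integer using (ℤ; +_; _-_) renaming (_+_ to _+ℤ_; _*_ to _*ℤ_)
open import Data.List using (List; []; _∷_; _++_; map; take; length; replicate; _∷ʳ_)
open import Data.List.Relation.Unary.All using (All)
open import Data.Product using (Σ; ∃; _×_; _,_)
open import Data.Sum using (_⊎_)
open import Relation.Nullary using (¬_)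
open import Relation.Binary.PropositionalEquality using (_≡_)

Even : ℕ → Set
Even n = ∃ λ k → n ≡ 2 * k

Odd : ℕ → Set
Odd n = ∃ λ k → n ≡ suc (2 * k)

data Step : Set where
  U D : Step

level : List Step → ℤ
level []       = + 0
level (U ∷ w)  = + 1 +ℤ level w
level (D ∷ w)  = Data.Integer.-[1+ 0 ] +ℤ level w

NeverBelow : List Step → Set
NeverBelow w = ∀ k → k ≤ length w → Data.Integer._≤_ (+ 0) (level (take k w))

-- Maximal runs of consecutive D-steps, listed as (start position, length).
-- runsGo p r w : p = current position, r = length of the D-run currently
-- being read (0 if none).  A run at the end of the word is maximal.
runsGo : ℕ → ℕ → List Step → List (ℕ × ℕ)
runsGo p zero    []       = []
runsGo p (suc r) []       = (p ∸ suc r , suc r) ∷ []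
runsGo p r       (D ∷ w)  = runsGo (suc p) (suc r) w
runsGo p zero    (U ∷ w)  = runsGo (suc p) zero w
runsGo p (suc r) (U ∷ w)  = (p ∸ suc r , suc r) ∷ runsGo (suc p) zero w

maxDRuns : List Step → List (ℕ × ℕ)
maxDRuns w = runsGo 0 0 w

-- a run (s , ℓ) ends on the x-axis iff the prefix of length s + ℓ has level 0
OddIfEndsOnAxis : List Step → ℕ × ℕ → Set
OddIfEndsOnAxis w (s , ℓ) = level (take (s + ℓ) w) ≡ + 0 → Odd ℓ

Admissible : List Step → Set
Admissible w = NeverBelow w × All (OddIfEndsOnAxis w) (maxDRuns w)

-- w ends with a D-step, its current down-run (maximal run containing the
-- last step) is  replicate (suc k) D  preceded by v (empty or ending in U),
-- and the run starts at level  level v = + m  where m satisfies Par.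
EndsWithDRunFrom : (ℕ → Set) → List Step → Set
EndsWithDRunFrom Par w =
  Σ (List Step) λ v → Σ ℕ λ k → Σ ℕ λ m →
    (w ≡ v ++ replicate (suc k) D) ×
    (v ≡ [] ⊎ (Σ (List Step) λ u → v ≡ u ∷ʳ U)) ×
    (level v ≡ + m) × Par m

FClass : ℕ → List Step → Set
FClass j w = Admissible w × level w ≡ + j × EndsWithDRunFrom Even w

HClass : ℕ → List Step → Set
HClass j w = Admissible w × level w ≡ + j × EndsWithDRunFrom Odd w

GClass : ℕ → List Step → Set
GClass j w = Admissible w × level w ≡ + j ×
             (w ≡ [] ⊎ (Σ (List Step) λ u → w ≡ u ∷ʳ U))

words : ℕ → List (List Step)
words zero    = [] ∷ []
words (suc n) = map (U ∷_) (words n) ++ map (D ∷_) (words n)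

data CountP {A : Set} (P : A → Set) : List A → ℕ → Set where
  cnil  : CountP P [] 0
  cyes  : ∀ {x xs m} → P x → CountP P xs m → CountP P (x ∷ xs) (suc m)
  cno   : ∀ {x xs m} → ¬ P x → CountP P xs m → CountP P (x ∷ xs) m

NumberOfLength : (List Step → Set) → ℕ → ℤ → Set
NumberOfLength P n c = Σ ℕ λ m → CountP P (words n) m × (+ m ≡ c)

Series : Set
Series = ℕ → ℤ

one : Series
one zero    = + 1
one (suc n) = + 0

_⊝_ : Series → Series → Series
(a ⊝ b) n = a n - b n

sumTo : ℕ → (ℕ → ℤ) → ℤ
sumTo zero    f = f 0
sumTo (suc n) f = sumTo n f +ℤ f (suc n)

_⊛_ : Series → Series → Series
(a ⊛ b) n = sumTo n (λ i → a i *ℤ b (n ∸ i))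

pow : Series → ℕ → Series
pow a zero    = one
pow a (suc k) = a ⊛ pow a k

zMul : ℕ → Series → Series
zMul zero    a n       = a n
zMul (suc k) a zero    = + 0
zMul (suc k) a (suc n) = zMul k a n

catalan : ℕ → ℕ
catalan k = ((2 * k) C k) / suc k

-- r₂(z) = (1 - √(1 - 4z²)) / (2z) = Σ_k Cat_k z^(2k+1)
r₂ : Series
r₂ n with n % 2
... | 1 = + catalan (n / 2)
... | _ = + 0

-- Read a word step by step, remembering its level, whether its last step is U, and otherwise the
-- parity of the length of its current down-run.  This decides admissibility (a D-step onto the
-- axis must complete a down-run of odd length) and the class g_j, f_j or h_j of the word, so the
-- class counts obey transfer recurrences in the length: U takes g_j, f_j, h_j to g_{j+1}; D takes
-- g_{j+1} and the even runs at level j+1 to odd runs at level j, and odd runs to even runs.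
-- The coefficients of r₂^j are the first-passage numbers b_j(n), with
-- b_{j+1}(n+1) = b_j(n) + b_{j+2}(n): b_1(2k+1) = Cat_k by the ballot formula, and b_1 ⋆ b_j
-- satisfies the same recurrence as b_{j+1}.  The claimed closed forms, written with b, satisfy
-- the transfer recurrences and the initial values, hence are the counts.

{-# OPTIONS --safe #-}
module Submission where

open import Defs
open import Data.Bool.Base using (if_then_else_)
import Data.Integer as ℤ
open ℤ using (ℤ; +_; -[1+_]) renaming (_+_ to _+ℤ_; _*_ to _*ℤ_; _≤_ to _≤ℤ_)
import Data.Integer.Properties as ℤ
open import Data.List using (List; []; _∷_; _++_; _∷ʳ_; map; take; length; replicate; foldl)
open import Data.List.Properties using (foldl-++; length-++; take-all; ++-assoc; ++-identityʳ; map-++; map-cong; map-∘)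
open import Data.List.Relation.Unary.All as All using (All; []; _∷_)
import Data.List.Relation.Unary.All.Properties as All
open import Data.List.Reverse using (Reverse; reverseView; []; _∶_∶ʳ_)
open import Data.Nat
open import Data.Nat.Combinatorics
  using (_C_; nCk≡nC[n∸k]; nCk+nC[k+1]≡[n+1]C[k+1]; nCk≡n!/k![n-k]!; k![n∸k]!∣n!; [n-k]*d[k+1]≡[k+1]*d[k])
open import Data.Nat.DivMod using (m≡m%n+[m/n]*n; m%n<n; m*n/n≡m; m/n*n≡m)
open import Data.Nat.ListAction using (sum)
open import Data.Nat.ListAction.Properties using (sum-++)
open import Data.Nat.Properties
open import Data.Nat.Solver using (module +-*-Solver)
open import Data.Parity.Base as ℙ using (Parity; 0ℙ; 1ℙ; _⁻¹)
open import Data.Parity.Properties as ℙ using (suc-homo-⁻¹; ⁻¹-selfInverse; +-homo-+; *-homo-*)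
open import Data.Product using (Σ; ∃; _×_; _,_; proj₁; proj₂)
open import Data.Sum using (_⊎_; inj₁; inj₂)
open import Function using (case_of_; id)
open import Function.Bundles using (_⇔_; mk⇔; Equivalence)
import Function.Properties.Equivalence as ⇔
open import Relation.Binary.Definitions using (DecidableEquality)
open import Relation.Binary.PropositionalEquality
open import Relation.Nullary using (¬_; Dec; does; yes; no; contradiction)
open import Relation.Nullary.Decidable using (map′; _×-dec_; dec-false)
open import Relation.Unary using (Decidable)
open import Algebra.Properties.CommutativeSemigroup +-commutativeSemigroup using () renaming (interchange to ℕ-interchange)
open import Algebra.Properties.CommutativeSemigroup *-commutativeSemigroup using (x∙yz≈y∙xz)
open import Algebra.Properties.CommutativeSemigroup ℤ.+-commutativeSemigroup using (interchange)
open +-*-Solver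

parity-suc : ∀ n → parity (suc n) ≡ parity n ⁻¹
parity-suc n = sym (⁻¹-selfInverse (suc-homo-⁻¹ n))

parity[2*k]≡0ℙ : ∀ k → parity (2 * k) ≡ 0ℙ
parity[2*k]≡0ℙ k = *-homo-* 2 k

even-or-odd : ∀ m → Even m ⊎ Odd m
even-or-odd zero    = inj₁ (0 , refl)
even-or-odd (suc m) with even-or-odd m
... | inj₁ (k , m≡2k)   = inj₂ (k , cong suc m≡2k)
... | inj₂ (k , m≡2k+1) = inj₁ (suc k , cong suc (trans m≡2k+1 (sym (+-suc k (k + 0)))))

Even⇒parity≡0ℙ : ∀ {m} → Even m → parity m ≡ 0ℙ
Even⇒parity≡0ℙ (k , refl) = parity[2*k]≡0ℙ k

Odd⇒parity≡1ℙ : ∀ {m} → Odd m → parity m ≡ 1ℙ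
Odd⇒parity≡1ℙ (k , refl) = trans (parity-suc (2 * k)) (cong _⁻¹ (parity[2*k]≡0ℙ k))

parity≡0ℙ⇒Even : ∀ {m} → parity m ≡ 0ℙ → Even m
parity≡0ℙ⇒Even {m} m≡0ℙ with even-or-odd m
... | inj₁ even = even
... | inj₂ odd  = case trans (sym (Odd⇒parity≡1ℙ odd)) m≡0ℙ of λ ()

parity≡1ℙ⇒Odd : ∀ {m} → parity m ≡ 1ℙ → Odd m
parity≡1ℙ⇒Odd {m} m≡1ℙ with even-or-odd m
... | inj₁ even = case trans (sym (Even⇒parity≡0ℙ even)) m≡1ℙ of λ ()
... | inj₂ odd  = odd

Even⇔parity≡0ℙ : ∀ m → Even m ⇔ parity m ≡ 0ℙ
Even⇔parity≡0ℙ m = mk⇔ Even⇒parity≡0ℙ parity≡0ℙ⇒Even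

Odd⇔parity≡1ℙ : ∀ m → Odd m ⇔ parity m ≡ 1ℙ
Odd⇔parity≡1ℙ m = mk⇔ Odd⇒parity≡1ℙ parity≡1ℙ⇒Odd

parity-+-transpose : ∀ j t r → parity (j + t) ≡ r ⇔ parity t ≡ r ℙ.+ parity j
parity-+-transpose j t r rewrite +-homo-+ j t = mk⇔ (to (parity j) (parity t)) (from (parity j) r)
  where
  to : ∀ p q {r} → p ℙ.+ q ≡ r → q ≡ r ℙ.+ p
  to 0ℙ 0ℙ refl = refl
  to 0ℙ 1ℙ refl = refl
  to 1ℙ 0ℙ refl = refl
  to 1ℙ 1ℙ refl = refl
  from : ∀ p r {q} → q ≡ r ℙ.+ p → p ℙ.+ q ≡ r
  from 0ℙ 0ℙ refl = refl
  from 0ℙ 1ℙ refl = refl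
  from 1ℙ 0ℙ refl = refl
  from 1ℙ 1ℙ refl = refl

-- First-passage numbers and the powers of r₂

-- The number of n-step ±1 walks from height j that first reach height 0 at their last step,
-- i.e. the coefficient of z^n in r₂^j.
firstPassage : ℕ → ℕ → ℕ
firstPassage zero    zero    = 1
firstPassage zero    (suc n) = 0
firstPassage (suc j) zero    = 0
firstPassage (suc j) (suc n) = firstPassage j n + firstPassage (suc (suc j)) n

firstPassage-parity : ∀ j n → parity j ≢ parity n → firstPassage j n ≡ 0
firstPassage-parity zero    zero    j≢n = contradiction refl j≢n
firstPassage-parity zero    (suc n) _   = refl
firstPassage-parity (suc j) zero    _   = refl
firstPassage-parity (suc j) (suc n) j+1≢n+1 =
  cong₂ _+_ (firstPassage-parity j n j≢n) (firstPassage-parity (suc (suc j)) n j≢n)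
  where
  j≢n : parity j ≢ parity n
  j≢n j≡n = j+1≢n+1 (trans (parity-suc j) (trans (cong _⁻¹ j≡n) (sym (parity-suc n))))

firstPassage-< : ∀ j n → n < j → firstPassage j n ≡ 0
firstPassage-< (suc j) zero    _         = refl
firstPassage-< (suc j) (suc n) (s≤s n<j) =
  cong₂ _+_ (firstPassage-< j n n<j) (firstPassage-< (suc (suc j)) n (m<n⇒m<1+n (m<n⇒m<1+n n<j)))

firstPassage-diag : ∀ j → firstPassage j j ≡ 1
firstPassage-diag zero    = refl
firstPassage-diag (suc j) = cong₂ _+_ (firstPassage-diag j) (firstPassage-< (suc (suc j)) j (m<n⇒m<1+n (n<1+n j)))

-- x C (m - 1), except that it is 0 (not x C 0) at m = 0.
binomialPred : ℕ → ℕ → ℕ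
binomialPred x zero    = 0
binomialPred x (suc m) = x C m

[1+x]Cm≡binomialPred+xCm : ∀ x m → suc x C m ≡ binomialPred x m + x C m
[1+x]Cm≡binomialPred+xCm x zero    = refl
[1+x]Cm≡binomialPred+xCm x (suc m) = sym (nCk+nC[k+1]≡[n+1]C[k+1] x m)

-- The ballot formula b_{i+1}(i+1+2m) = C(i+2m, m) - C(i+2m, m-1), with the subtraction moved to the left.
firstPassage-ballot : ∀ i m → firstPassage (suc i) (suc i + 2 * m) + binomialPred (i + 2 * m) m ≡ (i + 2 * m) C m
firstPassage-ballot i zero =
  trans (+-identityʳ _) (trans (cong (firstPassage (suc i)) (+-identityʳ (suc i))) (firstPassage-diag (suc i)))
firstPassage-ballot zero (suc m) = begin
  firstPassage 1 (1 + 2 * suc m) + (2 * suc m) C m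
    ≡⟨ cong (λ y → firstPassage 1 (suc y) + y C m) (sym x+1≡2[m+1]) ⟩
  firstPassage 2 (suc x) + suc x C m
    ≡⟨ cong (λ y → firstPassage 2 (suc x) + y) ([1+x]Cm≡binomialPred+xCm x m) ⟩
  firstPassage 2 (suc x) + (binomialPred x m + x C m)
    ≡⟨ +-assoc (firstPassage 2 (suc x)) (binomialPred x m) (x C m) ⟨
  (firstPassage 2 (suc x) + binomialPred x m) + x C m
    ≡⟨ cong₂ _+_ (firstPassage-ballot 1 m) xCm≡xC[m+1] ⟩
  x C m + x C suc m
    ≡⟨ nCk+nC[k+1]≡[n+1]C[k+1] x m ⟩
  suc x C suc m
    ≡⟨ cong (_C suc m) x+1≡2[m+1] ⟩
  (2 * suc m) C suc m  ∎
  where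
  open ≡-Reasoning
  x = 1 + 2 * m
  x+1≡2[m+1] : suc x ≡ 2 * suc m
  x+1≡2[m+1] = solve 1 (λ m → con 1 :+ (con 1 :+ con 2 :* m) := con 2 :* (con 1 :+ m)) refl m
  x∸[m+1]≡m : x ∸ suc m ≡ m
  x∸[m+1]≡m = trans (cong (_∸ suc m) (solve 1 (λ m → con 1 :+ con 2 :* m := m :+ (con 1 :+ m)) refl m)) (m+n∸n≡m m (suc m))
  xCm≡xC[m+1] : x C m ≡ x C suc m
  xCm≡xC[m+1] = sym (trans (nCk≡nC[n∸k] (s≤s (m≤m+n m (m + 0)))) (cong (x C_) x∸[m+1]≡m))
firstPassage-ballot (suc i) (suc m) = begin
  (firstPassage (suc i) (suc X) + firstPassage (3 + i) (suc X)) + suc X C m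
    ≡⟨ cong (λ y → firstPassage (suc i) (suc X) + firstPassage (3 + i) (suc X) + y) ([1+x]Cm≡binomialPred+xCm X m) ⟩
  (firstPassage (suc i) (suc X) + firstPassage (3 + i) (suc X)) + (binomialPred X m + X C m)
    ≡⟨ regroup (firstPassage (suc i) (suc X)) (firstPassage (3 + i) (suc X)) (binomialPred X m) (X C m) ⟩
  (firstPassage (suc i) (suc X) + X C m) + (firstPassage (3 + i) (suc X) + binomialPred X m)
    ≡⟨ cong₂ _+_ (firstPassage-ballot i (suc m)) ballot[i+2,m] ⟩
  X C suc m + X C m
    ≡⟨ +-comm (X C suc m) (X C m) ⟩
  X C m + X C suc m
    ≡⟨ nCk+nC[k+1]≡[n+1]C[k+1] X m ⟩
  suc X C suc m  ∎
  where
  open ≡-Reasoning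
  X = i + 2 * suc m
  X≡2+i+2m : X ≡ 2 + i + 2 * m
  X≡2+i+2m = solve 2 (λ i m → i :+ con 2 :* (con 1 :+ m) := con 2 :+ i :+ con 2 :* m) refl i m
  ballot[i+2,m] : firstPassage (3 + i) (suc X) + binomialPred X m ≡ X C m
  ballot[i+2,m] = subst (λ y → firstPassage (3 + i) (suc y) + binomialPred y m ≡ y C m) (sym X≡2+i+2m)
                  (firstPassage-ballot (2 + i) m)
  regroup : ∀ a b c d → (a + b) + (c + d) ≡ (a + d) + (b + c)
  regroup = solve 4 (λ a b c d → (a :+ b) :+ (c :+ d) := (a :+ d) :+ (b :+ c)) refl

nCk*k![n∸k]!≡n! : ∀ {n k} → k ≤ n → (n C k) * (k ! * (n ∸ k) !) ≡ n !
nCk*k![n∸k]!≡n! {n} {k} k≤n = trans (cong (_* (k ! * (n ∸ k) !)) (nCk≡n!/k![n-k]! k≤n)) (m/n*n≡m (k![n∸k]!∣n! k≤n))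
  where instance _ = k !* (n ∸ k) !≢0

[1+k]*nC[1+k]≡[n∸k]*nCk : ∀ {n k} → k < n → suc k * (n C suc k) ≡ (n ∸ k) * (n C k)
[1+k]*nC[1+k]≡[n∸k]*nCk {n} {k} k<n = *-cancelʳ-≡ _ _ d[k+1] {{(suc k) !* (n ∸ suc k) !≢0}} (begin
  suc k * (n C suc k) * d[k+1]    ≡⟨ *-assoc (suc k) (n C suc k) d[k+1] ⟩
  suc k * ((n C suc k) * d[k+1])  ≡⟨ cong (suc k *_) (nCk*k![n∸k]!≡n! k<n) ⟩
  suc k * n !                     ≡⟨ cong (suc k *_) (nCk*k![n∸k]!≡n! (<⇒≤ k<n)) ⟨
  suc k * ((n C k) * d[k])        ≡⟨ x∙yz≈y∙xz (suc k) (n C k) d[k] ⟩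
  (n C k) * (suc k * d[k])        ≡⟨ cong ((n C k) *_) ([n-k]*d[k+1]≡[k+1]*d[k] k<n) ⟨
  (n C k) * ((n ∸ k) * d[k+1])    ≡⟨ *-assoc (n C k) (n ∸ k) d[k+1] ⟨
  (n C k) * (n ∸ k) * d[k+1]      ≡⟨ cong (_* d[k+1]) (*-comm (n C k) (n ∸ k)) ⟩
  (n ∸ k) * (n C k) * d[k+1]      ∎)
  where
  open ≡-Reasoning
  d[k] = k ! * (n ∸ k) !
  d[k+1] = suc k ! * (n ∸ suc k) !

[1+k]*binomialPred≡k*central : ∀ k → suc k * binomialPred (2 * k) k ≡ k * ((2 * k) C k)
[1+k]*binomialPred≡k*central zero    = refl
[1+k]*binomialPred≡k*central (suc k) = sym (trans ([1+k]*nC[1+k]≡[n∸k]*nCk k<n) (cong (_* (n C k)) n∸k≡2+k))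
  where
  n = 2 * suc k
  k<n : k < n
  k<n = m≤n*m (suc k) 2
  n∸k≡2+k : n ∸ k ≡ 2 + k
  n∸k≡2+k = trans (cong (_∸ k) (solve 1 (λ k → con 2 :* (con 1 :+ k) := (con 2 :+ k) :+ k) refl k)) (m+n∸n≡m (2 + k) k)

catalan≡firstPassage : ∀ k → catalan k ≡ firstPassage 1 (1 + 2 * k)
catalan≡firstPassage k = trans (cong (_/ suc k) central≡f*[1+k]) (m*n/n≡m f (suc k))
  where
  open ≡-Reasoning
  f = firstPassage 1 (1 + 2 * k)
  central = (2 * k) C k
  central≡f*[1+k] : central ≡ f * suc k
  central≡f*[1+k] = +-cancelʳ-≡ (k * central) central (f * suc k) (begin
    suc k * central                              ≡⟨ cong (suc k *_) (firstPassage-ballot 0 k) ⟨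
    suc k * (f + binomialPred (2 * k) k)           ≡⟨ *-distribˡ-+ (suc k) f _ ⟩
    suc k * f + suc k * binomialPred (2 * k) k     ≡⟨ cong₂ _+_ (*-comm (suc k) f) ([1+k]*binomialPred≡k*central k) ⟩
    f * suc k + k * central                      ∎)

r₂≡firstPassage : ∀ n → r₂ n ≡ + firstPassage 1 n
r₂≡firstPassage n with n % 2 | m≡m%n+[m/n]*n n 2 | m%n<n n 2
... | 0 | n≡[n/2]*2 | _ = cong +_ (sym (firstPassage-parity 1 n (λ 1ℙ≡n → ℙ.p≢p⁻¹ 1ℙ (trans 1ℙ≡n n≡0ℙ))))
  where
  n≡0ℙ : parity n ≡ 0ℙ
  n≡0ℙ = Even⇒parity≡0ℙ (n / 2 , trans n≡[n/2]*2 (*-comm (n / 2) 2))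
... | 1 | n≡1+[n/2]*2 | _ =
  cong +_ (trans (catalan≡firstPassage (n / 2)) (cong (firstPassage 1) (sym (trans n≡1+[n/2]*2 (cong suc (*-comm (n / 2) 2))))))
... | suc (suc _) | _ | s≤s (s≤s ())

sumTo-cong : ∀ n {f g : ℕ → ℤ} → (∀ i → i ≤ n → f i ≡ g i) → sumTo n f ≡ sumTo n g
sumTo-cong zero    f≗g = f≗g 0 z≤n
sumTo-cong (suc n) f≗g = cong₂ _+ℤ_ (sumTo-cong n (λ i i≤n → f≗g i (m≤n⇒m≤1+n i≤n))) (f≗g (suc n) ≤-refl)

sumTo-+ : ∀ n (f g : ℕ → ℤ) → sumTo n (λ i → f i +ℤ g i) ≡ sumTo n f +ℤ sumTo n g
sumTo-+ zero    f g = refl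
sumTo-+ (suc n) f g =
  trans (cong (_+ℤ (f (suc n) +ℤ g (suc n))) (sumTo-+ n f g)) (interchange (sumTo n f) (sumTo n g) (f (suc n)) (g (suc n)))

sumTo-0 : ∀ n → sumTo n (λ _ → + 0) ≡ + 0
sumTo-0 zero    = refl
sumTo-0 (suc n) = trans (ℤ.+-identityʳ (sumTo n (λ _ → + 0))) (sumTo-0 n)

firstPassageSeries : ℕ → Series
firstPassageSeries j n = + firstPassage j n

firstPassageSeries-⊛ : ∀ j n → (firstPassageSeries 1 ⊛ firstPassageSeries j) n ≡ firstPassageSeries (suc j) n
firstPassageSeries-⊛ j zero = refl
firstPassageSeries-⊛ zero (suc n) = begin
  sumTo n (λ i → P 1 i *ℤ P 0 (suc n ∸ i)) +ℤ P 1 (suc n) *ℤ P 0 (n ∸ n)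
    ≡⟨ cong₂ _+ℤ_ (trans (sumTo-cong n early-terms) (sumTo-0 n)) (cong (λ m → P 1 (suc n) *ℤ P 0 m) (n∸n≡0 n)) ⟩
  + 0 +ℤ P 1 (suc n) *ℤ + 1
    ≡⟨ trans (ℤ.+-identityˡ _) (ℤ.*-identityʳ (P 1 (suc n))) ⟩
  P 1 (suc n)  ∎
  where
  open ≡-Reasoning
  P = firstPassageSeries
  early-terms : ∀ i → i ≤ n → P 1 i *ℤ P 0 (suc n ∸ i) ≡ + 0
  early-terms i i≤n = trans (cong (λ m → P 1 i *ℤ P 0 m) (+-∸-assoc 1 i≤n)) (ℤ.*-zeroʳ (P 1 i))
firstPassageSeries-⊛ (suc j) (suc n) = begin
  sumTo n (λ i → P 1 i *ℤ P (suc j) (suc n ∸ i)) +ℤ P 1 (suc n) *ℤ P (suc j) (n ∸ n)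
    ≡⟨ cong₂ _+ℤ_ (sumTo-cong n early-terms) (cong (λ m → P 1 (suc n) *ℤ P (suc j) m) (n∸n≡0 n)) ⟩
  sumTo n (λ i → P 1 i *ℤ P j (n ∸ i) +ℤ P 1 i *ℤ P (2 + j) (n ∸ i)) +ℤ P 1 (suc n) *ℤ + 0
    ≡⟨ cong₂ _+ℤ_ (sumTo-+ n _ _) (ℤ.*-zeroʳ (P 1 (suc n))) ⟩
  (sumTo n (λ i → P 1 i *ℤ P j (n ∸ i)) +ℤ sumTo n (λ i → P 1 i *ℤ P (2 + j) (n ∸ i))) +ℤ + 0
    ≡⟨ ℤ.+-identityʳ _ ⟩
  sumTo n (λ i → P 1 i *ℤ P j (n ∸ i)) +ℤ sumTo n (λ i → P 1 i *ℤ P (2 + j) (n ∸ i))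
    ≡⟨ cong₂ _+ℤ_ (firstPassageSeries-⊛ j n) (firstPassageSeries-⊛ (2 + j) n) ⟩
  P (suc j) n +ℤ P (3 + j) n
    ≡⟨ ℤ.pos-+ (firstPassage (suc j) n) (firstPassage (3 + j) n) ⟨
  P (2 + j) (suc n)  ∎
  where
  open ≡-Reasoning
  P = firstPassageSeries
  early-terms : ∀ i → i ≤ n → P 1 i *ℤ P (suc j) (suc n ∸ i) ≡ P 1 i *ℤ P j (n ∸ i) +ℤ P 1 i *ℤ P (2 + j) (n ∸ i)
  early-terms i i≤n = begin
    P 1 i *ℤ P (suc j) (suc n ∸ i)              ≡⟨ cong (λ m → P 1 i *ℤ P (suc j) m) (+-∸-assoc 1 i≤n) ⟩
    P 1 i *ℤ P (suc j) (suc (n ∸ i))            ≡⟨ cong (P 1 i *ℤ_) (ℤ.pos-+ (firstPassage j (n ∸ i)) _) ⟩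
    P 1 i *ℤ (P j (n ∸ i) +ℤ P (2 + j) (n ∸ i))  ≡⟨ ℤ.*-distribˡ-+ (P 1 i) _ _ ⟩
    P 1 i *ℤ P j (n ∸ i) +ℤ P 1 i *ℤ P (2 + j) (n ∸ i)  ∎

pow-r₂ : ∀ j n → pow r₂ j n ≡ firstPassageSeries j n
pow-r₂ zero    zero    = refl
pow-r₂ zero    (suc n) = refl
pow-r₂ (suc j) n = trans (sumTo-cong n (λ i _ → cong₂ _*ℤ_ (r₂≡firstPassage i) (pow-r₂ j (n ∸ i))))
                         (firstPassageSeries-⊛ j n)

pow-r₂-+2 : ∀ j m → pow r₂ (j + 2) m ≡ + firstPassage (2 + j) m
pow-r₂-+2 j m = trans (pow-r₂ (j + 2) m) (cong (λ i → + firstPassage i m) (+-comm j 2))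

take-++-≤ : ∀ {A : Set} {k} (w ys : List A) → k ≤ length w → take k (w ++ ys) ≡ take k w
take-++-≤ {k = zero}  w       ys _         = refl
take-++-≤ {k = suc k} (x ∷ w) ys (s≤s k≤w) = cong (x ∷_) (take-++-≤ w ys k≤w)

length-∷ʳ : ∀ {A : Set} (w : List A) x → length (w ∷ʳ x) ≡ suc (length w)
length-∷ʳ w x = trans (length-++ w) (+-comm (length w) 1)

replicate-∷ʳ : ∀ {A : Set} n (x : A) → replicate n x ∷ʳ x ≡ x ∷ replicate n x
replicate-∷ʳ zero    x = refl
replicate-∷ʳ (suc n) x = cong (x ∷_) (replicate-∷ʳ n x)

level-++ : ∀ v w → level (v ++ w) ≡ level v +ℤ level w
level-++ []      w = sym (ℤ.+-identityˡ (level w))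
level-++ (U ∷ v) w = trans (cong ((+ 1) +ℤ_) (level-++ v w)) (sym (ℤ.+-assoc (+ 1) (level v) (level w)))
level-++ (D ∷ v) w = trans (cong (-[1+ 0 ] +ℤ_) (level-++ v w)) (sym (ℤ.+-assoc -[1+ 0 ] (level v) (level w)))

level-∷ʳU : ∀ w {j} → level w ≡ + j → level (w ∷ʳ U) ≡ + suc j
level-∷ʳU w {j} w≡j = trans (level-++ w (U ∷ [])) (trans (cong (_+ℤ + 1) w≡j) (cong +_ (+-comm j 1)))

level-∷ʳD : ∀ w {j} → level w ≡ + suc j → level (w ∷ʳ D) ≡ + j
level-∷ʳD w {j} w≡j+1 = trans (level-++ w (D ∷ [])) (cong (_+ℤ -[1+ 0 ]) w≡j+1)

level-∷ʳD-axis : ∀ w → level w ≡ + 0 → level (w ∷ʳ D) ≡ -[1+ 0 ]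
level-∷ʳD-axis w w≡0 = trans (level-++ w (D ∷ [])) (cong (_+ℤ -[1+ 0 ]) w≡0)

0≤level : ∀ w {j} → level w ≡ + j → + 0 ≤ℤ level w
0≤level w w≡j = subst (+ 0 ≤ℤ_) (sym w≡j) (ℤ.+≤+ z≤n)

level-take-length : ∀ w → level (take (length w) w) ≡ level w
level-take-length w = cong level (take-all (length w) w ≤-refl)

level-replicateD : ∀ n → level (replicate n D) ≡ ℤ.- (+ n)
level-replicateD zero          = refl
level-replicateD (suc zero)    = refl
level-replicateD (suc (suc n)) = cong (-[1+ 0 ] +ℤ_) (level-replicateD (suc n))

level-before-replicateD : ∀ v n {j} → level (v ++ replicate n D) ≡ + j → level v ≡ + (j + n)
level-before-replicateD v n {j} v++Ds≡j = begin
  level v                                    ≡⟨ ℤ.+-identityʳ (level v) ⟨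
  level v +ℤ + 0                             ≡⟨ cong (level v +ℤ_) (ℤ.+-inverseˡ (+ n)) ⟨
  level v +ℤ (ℤ.- (+ n) +ℤ + n)              ≡⟨ ℤ.+-assoc (level v) (ℤ.- (+ n)) (+ n) ⟨
  (level v +ℤ ℤ.- (+ n)) +ℤ + n              ≡⟨ cong (λ x → (level v +ℤ x) +ℤ + n) (level-replicateD n) ⟨
  (level v +ℤ level (replicate n D)) +ℤ + n  ≡⟨ cong (_+ℤ + n) (level-++ v (replicate n D)) ⟨
  level (v ++ replicate n D) +ℤ + n          ≡⟨ cong (_+ℤ + n) v++Ds≡j ⟩
  + (j + n)                                  ∎
  where open ≡-Reasoning

NeverBelow-∷ʳ⁻ : ∀ w x → NeverBelow (w ∷ʳ x) → NeverBelow w × + 0 ≤ℤ level (w ∷ʳ x)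
NeverBelow-∷ʳ⁻ w x never-below = below-w , subst (+ 0 ≤ℤ_) (level-take-length (w ∷ʳ x)) (never-below _ ≤-refl)
  where
  below-w : NeverBelow w
  below-w k k≤w = subst (λ v → + 0 ≤ℤ level v) (take-++-≤ w (x ∷ []) k≤w)
                        (never-below k (≤-trans k≤w (≤-trans (n≤1+n _) (≤-reflexive (sym (length-∷ʳ w x))))))

NeverBelow-∷ʳ⁺ : ∀ w x → NeverBelow w → + 0 ≤ℤ level (w ∷ʳ x) → NeverBelow (w ∷ʳ x)
NeverBelow-∷ʳ⁺ w x never-below 0≤wx k k≤wx with k ≤? length w
... | yes k≤w = subst (λ v → + 0 ≤ℤ level v) (sym (take-++-≤ w (x ∷ []) k≤w)) (never-below k k≤w)
... | no  k≰w = subst (λ v → + 0 ≤ℤ level v) (sym (take-all k (w ∷ʳ x) (≤-reflexive wx≡k))) 0≤wx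
  where
  wx≡k : length (w ∷ʳ x) ≡ k
  wx≡k = ≤-antisym (≤-trans (≤-reflexive (length-∷ʳ w x)) (≰⇒> k≰w)) k≤wx

extendRun : ℕ → Step → ℕ
extendRun _ U = 0
extendRun r D = suc r

trailingDs : List Step → ℕ
trailingDs = foldl extendRun 0

trailingDs-∷ʳU : ∀ w → trailingDs (w ∷ʳ U) ≡ 0
trailingDs-∷ʳU w = foldl-++ extendRun 0 w (U ∷ [])

trailingDs-∷ʳD : ∀ w → trailingDs (w ∷ʳ D) ≡ suc (trailingDs w)
trailingDs-∷ʳD w = foldl-++ extendRun 0 w (D ∷ [])

foldl-extendRun-replicateD : ∀ n r → foldl extendRun r (replicate n D) ≡ n + r
foldl-extendRun-replicateD zero    r = refl
foldl-extendRun-replicateD (suc n) r = trans (foldl-extendRun-replicateD n (suc r)) (+-suc n r)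

trailingDs-++-replicateD : ∀ v n → trailingDs (v ++ replicate n D) ≡ n + trailingDs v
trailingDs-++-replicateD v n = trans (foldl-++ extendRun 0 v (replicate n D)) (foldl-extendRun-replicateD n (trailingDs v))

closedRuns : ℕ → ℕ → List Step → List (ℕ × ℕ)
closedRuns p r       []      = []
closedRuns p r       (D ∷ w) = closedRuns (suc p) (suc r) w
closedRuns p zero    (U ∷ w) = closedRuns (suc p) zero w
closedRuns p (suc r) (U ∷ w) = (p ∸ suc r , suc r) ∷ closedRuns (suc p) zero w

finalRun : ℕ → ℕ → List (ℕ × ℕ)
finalRun p zero    = []
finalRun p (suc r) = (p ∸ suc r , suc r) ∷ []

runsGo≡closedRuns++finalRun : ∀ p r w →
  runsGo p r w ≡ closedRuns p r w ++ finalRun (p + length w) (foldl extendRun r w)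
runsGo≡closedRuns++finalRun p zero    []      = refl
runsGo≡closedRuns++finalRun p (suc r) []      rewrite +-identityʳ p = refl
runsGo≡closedRuns++finalRun p zero    (D ∷ w) rewrite +-suc p (length w) = runsGo≡closedRuns++finalRun (suc p) 1 w
runsGo≡closedRuns++finalRun p (suc r) (D ∷ w) rewrite +-suc p (length w) = runsGo≡closedRuns++finalRun (suc p) (2 + r) w
runsGo≡closedRuns++finalRun p zero    (U ∷ w) rewrite +-suc p (length w) = runsGo≡closedRuns++finalRun (suc p) zero w
runsGo≡closedRuns++finalRun p (suc r) (U ∷ w) rewrite +-suc p (length w) =
  cong (_ ∷_) (runsGo≡closedRuns++finalRun (suc p) zero w)

runsGo-∷ʳU : ∀ p r w → runsGo p r (w ∷ʳ U) ≡ runsGo p r w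
runsGo-∷ʳU p zero    []      = refl
runsGo-∷ʳU p (suc r) []      = refl
runsGo-∷ʳU p zero    (D ∷ w) = runsGo-∷ʳU (suc p) 1 w
runsGo-∷ʳU p (suc r) (D ∷ w) = runsGo-∷ʳU (suc p) (2 + r) w
runsGo-∷ʳU p zero    (U ∷ w) = runsGo-∷ʳU (suc p) zero w
runsGo-∷ʳU p (suc r) (U ∷ w) = cong (_ ∷_) (runsGo-∷ʳU (suc p) zero w)

runsGo-∷ʳD : ∀ p r w → let t = foldl extendRun r w in
  runsGo p r (w ∷ʳ D) ≡ closedRuns p r w ++ (p + length w ∸ t , suc t) ∷ []
runsGo-∷ʳD p zero    []      rewrite +-identityʳ p = refl
runsGo-∷ʳD p (suc r) []      rewrite +-identityʳ p = refl
runsGo-∷ʳD p zero    (D ∷ w) rewrite +-suc p (length w) = runsGo-∷ʳD (suc p) 1 w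
runsGo-∷ʳD p (suc r) (D ∷ w) rewrite +-suc p (length w) = runsGo-∷ʳD (suc p) (2 + r) w
runsGo-∷ʳD p zero    (U ∷ w) rewrite +-suc p (length w) = runsGo-∷ʳD (suc p) zero w
runsGo-∷ʳD p (suc r) (U ∷ w) rewrite +-suc p (length w) = cong (_ ∷_) (runsGo-∷ʳD (suc p) zero w)

EndsBy : ℕ → ℕ × ℕ → Set
EndsBy n (s , ℓ) = s + ℓ ≤ n

runsGo-endsBy : ∀ p r w → r ≤ p → All (EndsBy (p + length w)) (runsGo p r w)
runsGo-endsBy p zero    []      _   = []
runsGo-endsBy p (suc r) []      r≤p = ≤-trans (≤-reflexive (m∸n+n≡m r≤p)) (m≤m+n p 0) ∷ []
runsGo-endsBy p zero    (D ∷ w) r≤p rewrite +-suc p (length w) = runsGo-endsBy (suc p) 1 w (s≤s r≤p)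
runsGo-endsBy p (suc r) (D ∷ w) r≤p rewrite +-suc p (length w) = runsGo-endsBy (suc p) (2 + r) w (s≤s r≤p)
runsGo-endsBy p zero    (U ∷ w) r≤p rewrite +-suc p (length w) = runsGo-endsBy (suc p) zero w z≤n
runsGo-endsBy p (suc r) (U ∷ w) r≤p rewrite +-suc p (length w) =
  ≤-trans (≤-reflexive (m∸n+n≡m r≤p)) (m≤n⇒m≤1+n (m≤m+n p (length w))) ∷ runsGo-endsBy (suc p) zero w z≤n

foldl-extendRun-≤ : ∀ p r w → r ≤ p → foldl extendRun r w ≤ p + length w
foldl-extendRun-≤ p r []      r≤p = ≤-trans r≤p (m≤m+n p 0)
foldl-extendRun-≤ p r (D ∷ w) r≤p rewrite +-suc p (length w) = foldl-extendRun-≤ (suc p) (suc r) w (s≤s r≤p)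
foldl-extendRun-≤ p r (U ∷ w) r≤p rewrite +-suc p (length w) = foldl-extendRun-≤ (suc p) zero w z≤n

trailingDs-≤ : ∀ w → trailingDs w ≤ length w
trailingDs-≤ w = foldl-extendRun-≤ 0 0 w z≤n

closedRuns-endsBy : ∀ w → All (EndsBy (length w)) (closedRuns 0 0 w)
closedRuns-endsBy w = All.++⁻ˡ (closedRuns 0 0 w) (subst (All _) (runsGo≡closedRuns++finalRun 0 0 w) (runsGo-endsBy 0 0 w z≤n))

OddIfEndsOnAxis-++ : ∀ w ys q → EndsBy (length w) q → OddIfEndsOnAxis (w ++ ys) q ≡ OddIfEndsOnAxis w q
OddIfEndsOnAxis-++ w ys (s , ℓ) s+ℓ≤w = cong (λ v → level v ≡ + 0 → Odd ℓ) (take-++-≤ w ys s+ℓ≤w)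

All-OddIfEndsOnAxis-++⁻ : ∀ w ys {qs} → All (EndsBy (length w)) qs →
                          All (OddIfEndsOnAxis (w ++ ys)) qs → All (OddIfEndsOnAxis w) qs
All-OddIfEndsOnAxis-++⁻ w ys ends odd =
  All.zipWith (λ { {q} (q-ends , q-odd) → subst id (OddIfEndsOnAxis-++ w ys q q-ends) q-odd }) (ends , odd)

All-OddIfEndsOnAxis-++⁺ : ∀ w ys {qs} → All (EndsBy (length w)) qs →
                          All (OddIfEndsOnAxis w) qs → All (OddIfEndsOnAxis (w ++ ys)) qs
All-OddIfEndsOnAxis-++⁺ w ys ends odd =
  All.zipWith (λ { {q} (q-ends , q-odd) → subst id (sym (OddIfEndsOnAxis-++ w ys q q-ends)) q-odd }) (ends , odd)

take-through-lastRun : ∀ w → take (length w ∸ trailingDs w + suc (trailingDs w)) (w ∷ʳ D) ≡ w ∷ʳ D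
take-through-lastRun w = take-all _ (w ∷ʳ D) (≤-reflexive (sym whole))
  where
  whole : length w ∸ trailingDs w + suc (trailingDs w) ≡ length (w ∷ʳ D)
  whole = trans (+-suc _ (trailingDs w)) (trans (cong suc (m∸n+n≡m (trailingDs-≤ w))) (sym (length-∷ʳ w D)))

finalRun-offAxis : ∀ w t → t ≤ length w → level w ≢ + 0 → All (OddIfEndsOnAxis w) (finalRun (length w) t)
finalRun-offAxis w zero    _     _      = []
finalRun-offAxis w (suc t) t<w w≢0 = (λ w≡0 → contradiction (trans (sym (cong level whole)) w≡0) w≢0) ∷ []
  where
  whole : take (length w ∸ suc t + suc t) w ≡ w
  whole = take-all _ w (≤-reflexive (sym (m∸n+n≡m t<w)))

admissible-[] : Admissible []
admissible-[] = (λ { zero _ → ℤ.+≤+ z≤n ; (suc _) _ → ℤ.+≤+ z≤n }) , []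

admissible-∷ʳU⁻ : ∀ w → Admissible (w ∷ʳ U) → Admissible w
admissible-∷ʳU⁻ w (never-below , odd-runs) =
  proj₁ (NeverBelow-∷ʳ⁻ w U never-below) ,
  All-OddIfEndsOnAxis-++⁻ w (U ∷ []) (runsGo-endsBy 0 0 w z≤n) (subst (All _) (runsGo-∷ʳU 0 0 w) odd-runs)

admissible-∷ʳU⁺ : ∀ w → Admissible w → + 0 ≤ℤ level (w ∷ʳ U) → Admissible (w ∷ʳ U)
admissible-∷ʳU⁺ w (never-below , odd-runs) 0≤wU =
  NeverBelow-∷ʳ⁺ w U never-below 0≤wU ,
  subst (All _) (sym (runsGo-∷ʳU 0 0 w)) (All-OddIfEndsOnAxis-++⁺ w (U ∷ []) (runsGo-endsBy 0 0 w z≤n) odd-runs)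

admissible-∷ʳD⁻ : ∀ w → Admissible (w ∷ʳ D) →
  Admissible w × + 0 ≤ℤ level (w ∷ʳ D) × (level (w ∷ʳ D) ≡ + 0 → Odd (suc (trailingDs w)))
admissible-∷ʳD⁻ w (never-below , odd-runs) = (below-w , odd-runs-w) , 0≤wD , last-run-odd
  where
  below-w = proj₁ (NeverBelow-∷ʳ⁻ w D never-below)
  0≤wD = proj₂ (NeverBelow-∷ʳ⁻ w D never-below)
  odd-runs-wD = All.∷ʳ⁻ (subst (All _) (runsGo-∷ʳD 0 0 w) odd-runs)
  w≢0 : level w ≢ + 0
  w≢0 w≡0 = case subst (+ 0 ≤ℤ_) (level-∷ʳD-axis w w≡0) 0≤wD of λ ()
  odd-runs-w : All (OddIfEndsOnAxis w) (maxDRuns w)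
  odd-runs-w = subst (All _) (sym (runsGo≡closedRuns++finalRun 0 0 w))
    (All.++⁺ (All-OddIfEndsOnAxis-++⁻ w (D ∷ []) (closedRuns-endsBy w) (proj₁ odd-runs-wD))
             (finalRun-offAxis w (trailingDs w) (trailingDs-≤ w) w≢0))
  last-run-odd : level (w ∷ʳ D) ≡ + 0 → Odd (suc (trailingDs w))
  last-run-odd wD≡0 = proj₂ odd-runs-wD (trans (cong level (take-through-lastRun w)) wD≡0)

admissible-∷ʳD⁺ : ∀ w → Admissible w → + 0 ≤ℤ level (w ∷ʳ D) →
  (level (w ∷ʳ D) ≡ + 0 → Odd (suc (trailingDs w))) → Admissible (w ∷ʳ D)
admissible-∷ʳD⁺ w (never-below , odd-runs) 0≤wD last-run-odd =
  NeverBelow-∷ʳ⁺ w D never-below 0≤wD ,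
  subst (All _) (sym (runsGo-∷ʳD 0 0 w)) (All.∷ʳ⁺ odd-closed-runs
    (λ wD≡0 → last-run-odd (trans (cong level (sym (take-through-lastRun w))) wD≡0)))
  where
  odd-closed-runs : All (OddIfEndsOnAxis (w ∷ʳ D)) (closedRuns 0 0 w)
  odd-closed-runs = All-OddIfEndsOnAxis-++⁺ w (D ∷ []) (closedRuns-endsBy w)
    (All.++⁻ˡ (closedRuns 0 0 w) (subst (All _) (runsGo≡closedRuns++finalRun 0 0 w) odd-runs))

¬admissible-∷ʳD-axis : ∀ w → level w ≡ + 0 → ¬ Admissible (w ∷ʳ D)
¬admissible-∷ʳD-axis w w≡0 adm =
  case subst (+ 0 ≤ℤ_) (level-∷ʳD-axis w w≡0) (proj₁ (proj₂ (admissible-∷ʳD⁻ w adm))) of λ ()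

-- The automaton reading admissible words

-- The state reached after reading a word: up j if it is empty or ends with U at level j,
-- down j q if it ends with D at level j and its current down-run has length of parity q,
-- dead if it is not admissible.  The down-run started at level j + length, so f_j and h_j
-- correspond to down j (parity j) and down j (parity j ⁻¹).
data State : Set where
  up   : ℕ → State
  down : ℕ → Parity → State
  dead : State

-- A D-step from level j that extends a down-run of length parity q (0ℙ if there is none yet).
-- Reaching the axis is allowed only when the extended run has odd length, i.e. q = 0ℙ.
descend : ℕ → Parity → State
descend zero          _  = dead
descend (suc zero)    1ℙ = dead
descend (suc j)       q  = down j (q ⁻¹)

step : State → Step → State
step dead       _ = dead
step (up j)     U = up (suc j)
step (down j _) U = up (suc j)
step (up j)     D = descend j 0ℙ
step (down j q) D = descend j q

state : List Step → State
state = foldl step (up 0)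

state-∷ʳ : ∀ w x → state (w ∷ʳ x) ≡ step (state w) x
state-∷ʳ w x = foldl-++ step (up 0) w (x ∷ [])

Describes : State → List Step → Set
Describes (up j)     w = Admissible w × level w ≡ + j × trailingDs w ≡ 0
Describes (down j q) w = Admissible w × level w ≡ + j × NonZero (trailingDs w) × parity (trailingDs w) ≡ q
Describes dead       w = ¬ Admissible w

trailingDs-∷ʳD-parity : ∀ w {q} → parity (trailingDs w) ≡ q →
  NonZero (trailingDs (w ∷ʳ D)) × parity (trailingDs (w ∷ʳ D)) ≡ q ⁻¹
trailingDs-∷ʳD-parity w t≡q rewrite trailingDs-∷ʳD w = _ , trans (parity-suc (trailingDs w)) (cong _⁻¹ t≡q)

describes-∷ʳU : ∀ w {j} → Admissible w → level w ≡ + j → Describes (up (suc j)) (w ∷ʳ U)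
describes-∷ʳU w adm w≡j = admissible-∷ʳU⁺ w adm (0≤level (w ∷ʳ U) (level-∷ʳU w w≡j)) , level-∷ʳU w w≡j , trailingDs-∷ʳU w

describes-∷ʳD : ∀ w {j q} → Admissible w → level w ≡ + j → parity (trailingDs w) ≡ q → Describes (descend j q) (w ∷ʳ D)
describes-∷ʳD w {zero}             _   w≡0 _   = ¬admissible-∷ʳD-axis w w≡0
describes-∷ʳD w {suc zero} {1ℙ}    _   w≡1 t≡1ℙ adm =
  case trans (sym (Odd⇒parity≡1ℙ (proj₂ (proj₂ (admissible-∷ʳD⁻ w adm)) (level-∷ʳD w w≡1))))
             (trans (parity-suc (trailingDs w)) (cong _⁻¹ t≡1ℙ)) of λ ()
describes-∷ʳD w {suc zero} {0ℙ}    adm w≡1 t≡0ℙ =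
  admissible-∷ʳD⁺ w adm (0≤level (w ∷ʳ D) (level-∷ʳD w w≡1))
    (λ _ → parity≡1ℙ⇒Odd (trans (parity-suc (trailingDs w)) (cong _⁻¹ t≡0ℙ))) ,
  level-∷ʳD w w≡1 , trailingDs-∷ʳD-parity w t≡0ℙ
describes-∷ʳD w {suc (suc j)}      adm w≡j+2 t≡q =
  admissible-∷ʳD⁺ w adm (0≤level (w ∷ʳ D) (level-∷ʳD w w≡j+2))
    (λ wD≡0 → case trans (sym (level-∷ʳD w w≡j+2)) wD≡0 of λ ()) ,
  level-∷ʳD w w≡j+2 , trailingDs-∷ʳD-parity w t≡q

describes-step : ∀ s w x → Describes s w → Describes (step s x) (w ∷ʳ x)
describes-step dead       w U ¬adm                  = λ adm → ¬adm (admissible-∷ʳU⁻ w adm)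
describes-step dead       w D ¬adm                  = λ adm → ¬adm (proj₁ (admissible-∷ʳD⁻ w adm))
describes-step (up j)     w U (adm , w≡j , _)       = describes-∷ʳU w adm w≡j
describes-step (down j _) w U (adm , w≡j , _)       = describes-∷ʳU w adm w≡j
describes-step (up j)     w D (adm , w≡j , t≡0)     = describes-∷ʳD w adm w≡j (cong parity t≡0)
describes-step (down j _) w D (adm , w≡j , _ , t≡q) = describes-∷ʳD w adm w≡j t≡q

describes-state : ∀ w → Describes (state w) w
describes-state w = go (reverseView w)
  where
  go : ∀ {w} → Reverse w → Describes (state w) w
  go []            = admissible-[] , refl , refl
  go (w ∶ w′ ∶ʳ x) = subst (λ s → Describes s (w ∷ʳ x)) (sym (state-∷ʳ w x)) (describes-step (state w) w x (go w′))

EmptyOrEndsWithU : List Step → Set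
EmptyOrEndsWithU w = w ≡ [] ⊎ (Σ (List Step) λ u → w ≡ u ∷ʳ U)

EmptyOrEndsWithU⇒trailingDs≡0 : ∀ {w} → EmptyOrEndsWithU w → trailingDs w ≡ 0
EmptyOrEndsWithU⇒trailingDs≡0 (inj₁ refl)       = refl
EmptyOrEndsWithU⇒trailingDs≡0 (inj₂ (u , refl)) = trailingDs-∷ʳU u

trailingDs≡0⇒EmptyOrEndsWithU : ∀ w → trailingDs w ≡ 0 → EmptyOrEndsWithU w
trailingDs≡0⇒EmptyOrEndsWithU w = go (reverseView w)
  where
  go : ∀ {w} → Reverse w → trailingDs w ≡ 0 → EmptyOrEndsWithU w
  go []            _   = inj₁ refl
  go (w ∶ _ ∶ʳ U) _   = inj₂ (w , refl)
  go (w ∶ _ ∶ʳ D) t≡0 = case trans (sym (trailingDs-∷ʳD w)) t≡0 of λ ()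

splitAt-trailingDs : ∀ w → ∃ λ v → w ≡ v ++ replicate (trailingDs w) D × EmptyOrEndsWithU v
splitAt-trailingDs w = go (reverseView w)
  where
  go : ∀ {w} → Reverse w → ∃ λ v → w ≡ v ++ replicate (trailingDs w) D × EmptyOrEndsWithU v
  go []            = [] , refl , inj₁ refl
  go (w ∶ _ ∶ʳ U) rewrite trailingDs-∷ʳU w = w ∷ʳ U , sym (++-identityʳ (w ∷ʳ U)) , inj₂ (w , refl)
  go (w ∶ w′ ∶ʳ D) rewrite trailingDs-∷ʳD w with go w′
  ... | v , w≡v++Ds , v-form = v , trans (cong (_∷ʳ D) w≡v++Ds) (trans (++-assoc v _ (D ∷ []))
                                      (cong (v ++_) (replicate-∷ʳ (trailingDs w) D))) , v-form

endsWithDRunFrom⁻ : ∀ {Par w j} → level w ≡ + j → EndsWithDRunFrom Par w →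
                    NonZero (trailingDs w) × Par (j + trailingDs w)
endsWithDRunFrom⁻ {Par} {j = j} w≡j (v , k , m , refl , v-form , v≡m , par-m) =
  subst NonZero (sym t≡k+1) _ , subst Par (trans m≡j+k+1 (cong (_+_ j) (sym t≡k+1))) par-m
  where
  t≡k+1 : trailingDs (v ++ replicate (suc k) D) ≡ suc k
  t≡k+1 = trans (trailingDs-++-replicateD v (suc k))
                (trans (cong (_+_ (suc k)) (EmptyOrEndsWithU⇒trailingDs≡0 v-form)) (+-identityʳ (suc k)))
  m≡j+k+1 : m ≡ j + suc k
  m≡j+k+1 = ℤ.+-injective (trans (sym v≡m) (level-before-replicateD v (suc k) w≡j))

endsWithDRunFrom⁺ : ∀ {Par w j} → level w ≡ + j → NonZero (trailingDs w) → Par (j + trailingDs w) →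
                    EndsWithDRunFrom Par w
endsWithDRunFrom⁺ {w = w} {j} w≡j nz par with splitAt-trailingDs w
... | v , w≡v++Ds , v-form =
  v , pred t , j + t , subst (λ n → w ≡ v ++ replicate n D) (sym (suc-pred t {{nz}})) w≡v++Ds , v-form ,
  level-before-replicateD v t (trans (cong level (sym w≡v++Ds)) w≡j) , par
  where t = trailingDs w

GClass⇔state : ∀ j w → GClass j w ⇔ state w ≡ up j
GClass⇔state j w = mk⇔ to from
  where
  to : GClass j w → state w ≡ up j
  to (adm , w≡j , w-form) with state w | describes-state w
  ... | up k     | (_ , w≡k , _)      = cong up (ℤ.+-injective (trans (sym w≡k) w≡j))
  ... | down _ _ | (_ , _ , nz , _)   = contradiction (EmptyOrEndsWithU⇒trailingDs≡0 w-form) (≢-nonZero⁻¹ _ {{nz}})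
  ... | dead     | ¬adm               = contradiction adm ¬adm
  from : state w ≡ up j → GClass j w
  from w↦j with adm , w≡j , t≡0 ← subst (λ s → Describes s w) w↦j (describes-state w) =
    adm , w≡j , trailingDs≡0⇒EmptyOrEndsWithU w t≡0

downClass⇔state : ∀ {Par : ℕ → Set} j q → (∀ t → Par (j + t) ⇔ parity t ≡ q) → ∀ w →
  (Admissible w × level w ≡ + j × EndsWithDRunFrom Par w) ⇔ state w ≡ down j q
downClass⇔state {Par} j q Par⇔q w = mk⇔ to from
  where
  to : Admissible w × level w ≡ + j × EndsWithDRunFrom Par w → state w ≡ down j q
  to (adm , w≡j , ends) with endsWithDRunFrom⁻ w≡j ends | state w | describes-state w
  ... | nz , _   | up _     | (_ , _ , t≡0)        = contradiction t≡0 (≢-nonZero⁻¹ _ {{nz}})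
  ... | _  , par | down k r | (_ , w≡k , _ , t≡r) =
    cong₂ down (ℤ.+-injective (trans (sym w≡k) w≡j)) (trans (sym t≡r) (Equivalence.to (Par⇔q _) par))
  ... | _  , _   | dead     | ¬adm                 = contradiction adm ¬adm
  from : state w ≡ down j q → Admissible w × level w ≡ + j × EndsWithDRunFrom Par w
  from w↦jq with adm , w≡j , nz , t≡q ← subst (λ s → Describes s w) w↦jq (describes-state w) =
    adm , w≡j , endsWithDRunFrom⁺ w≡j nz (Equivalence.from (Par⇔q _) t≡q)

FClass⇔state : ∀ j w → FClass j w ⇔ state w ≡ down j (parity j)
FClass⇔state j = downClass⇔state j (parity j) (λ t → ⇔.trans (Even⇔parity≡0ℙ (j + t)) (parity-+-transpose j t 0ℙ))

HClass⇔state : ∀ j w → HClass j w ⇔ state w ≡ down j (parity j ⁻¹)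
HClass⇔state j = downClass⇔state j (parity j ⁻¹) (λ t → ⇔.trans (Odd⇔parity≡1ℙ (j + t)) (parity-+-transpose j t 1ℙ))

𝟙 : ∀ {A : Set} → Dec A → ℕ
𝟙 a? = if does a? then 1 else 0

∑ : ∀ {A : Set} → (A → ℕ) → List A → ℕ
∑ f xs = sum (map f xs)

∑-cong : ∀ {A : Set} {f g : A → ℕ} xs → (∀ x → f x ≡ g x) → ∑ f xs ≡ ∑ g xs
∑-cong xs f≗g = cong sum (map-cong f≗g xs)

∑-+ : ∀ {A : Set} (f g : A → ℕ) xs → ∑ (λ x → f x + g x) xs ≡ ∑ f xs + ∑ g xs
∑-+ f g []       = refl
∑-+ f g (x ∷ xs) = trans (cong (λ s → f x + g x + s) (∑-+ f g xs)) (ℕ-interchange (f x) (g x) (∑ f xs) (∑ g xs))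

∑-0 : ∀ {A : Set} (xs : List A) → ∑ (λ _ → 0) xs ≡ 0
∑-0 []       = refl
∑-0 (_ ∷ xs) = ∑-0 xs

∑-++-map : ∀ {A B : Set} (f : B → ℕ) (g h : A → B) xs → ∑ f (map g xs ++ map h xs) ≡ ∑ (λ x → f (g x)) xs + ∑ (λ x → f (h x)) xs
∑-++-map f g h xs = trans (cong sum (map-++ f (map g xs) (map h xs)))
  (trans (sum-++ (map f (map g xs)) (map f (map h xs))) (sym (cong₂ (λ a b → sum a + sum b) (map-∘ xs) (map-∘ xs))))

CountP-∑ : ∀ {A : Set} {P Q : A → Set} (Q? : Decidable Q) → (∀ x → P x ⇔ Q x) → ∀ xs → CountP P xs (∑ (λ x → 𝟙 (Q? x)) xs)
CountP-∑ Q? P⇔Q []       = cnil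
CountP-∑ Q? P⇔Q (x ∷ xs) with Q? x
... | yes qx = cyes (Equivalence.from (P⇔Q x) qx) (CountP-∑ Q? P⇔Q xs)
... | no ¬qx = cno (λ px → ¬qx (Equivalence.to (P⇔Q x) px)) (CountP-∑ Q? P⇔Q xs)

∑-words-suc : ∀ n (f : List Step → ℕ) →
  ∑ f (words (suc n)) ≡ ∑ (λ w → f (w ∷ʳ U)) (words n) + ∑ (λ w → f (w ∷ʳ D)) (words n)
∑-words-suc zero    f = cong (_+ (f (D ∷ []) + 0)) (sym (+-identityʳ (f (U ∷ []))))
∑-words-suc (suc n) f = begin
  ∑ f (words (2 + n))
    ≡⟨ ∑-++-map f (U ∷_) (D ∷_) (words (suc n)) ⟩
  ∑ (λ w → f (U ∷ w)) (words (suc n)) + ∑ (λ w → f (D ∷ w)) (words (suc n))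
    ≡⟨ cong₂ _+_ (∑-words-suc n (λ w → f (U ∷ w))) (∑-words-suc n (λ w → f (D ∷ w))) ⟩
  (UwU + UwD) + (DwU + DwD)
    ≡⟨ ℕ-interchange UwU UwD DwU DwD ⟩
  (UwU + DwU) + (UwD + DwD)
    ≡⟨ cong₂ _+_ (∑-++-map (λ w → f (w ∷ʳ U)) (U ∷_) (D ∷_) ws) (∑-++-map (λ w → f (w ∷ʳ D)) (U ∷_) (D ∷_) ws) ⟨
  ∑ (λ w → f (w ∷ʳ U)) (words (suc n)) + ∑ (λ w → f (w ∷ʳ D)) (words (suc n))  ∎
  where
  open ≡-Reasoning
  ws = words n
  UwU = ∑ (λ w → f (U ∷ w ∷ʳ U)) ws
  UwD = ∑ (λ w → f (U ∷ w ∷ʳ D)) ws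
  DwU = ∑ (λ w → f (D ∷ w ∷ʳ U)) ws
  DwD = ∑ (λ w → f (D ∷ w ∷ʳ D)) ws

up-injective : ∀ {j k} → up j ≡ up k → j ≡ k
up-injective refl = refl

down-injective : ∀ {j k p q} → down j p ≡ down k q → p ≡ q × j ≡ k
down-injective refl = refl , refl

_≟ˢ_ : DecidableEquality State
up j     ≟ˢ up k     = map′ (cong up) up-injective (j ≟ k)
down j p ≟ˢ down k q = map′ (λ (p≡q , j≡k) → cong₂ down j≡k p≡q) down-injective (p ℙ.≟ q ×-dec j ≟ k)
dead     ≟ˢ dead     = yes refl
up _     ≟ˢ down _ _ = no λ ()
up _     ≟ˢ dead     = no λ ()
down _ _ ≟ˢ up _     = no λ ()
down _ _ ≟ˢ dead     = no λ ()
dead     ≟ˢ up _     = no λ ()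
dead     ≟ˢ down _ _ = no λ ()

δ : State → State → ℕ
δ s t = 𝟙 (s ≟ˢ t)

δ-≢ : ∀ {s t} → s ≢ t → δ s t ≡ 0
δ-≢ {s} {t} s≢t = cong (λ b → if b then 1 else 0) (dec-false (s ≟ˢ t) s≢t)

count : ℕ → State → ℕ
count n t = ∑ (λ w → δ (state w) t) (words n)

count-suc : ∀ n t → count (suc n) t ≡ ∑ (λ w → δ (step (state w) U) t) (words n) + ∑ (λ w → δ (step (state w) D) t) (words n)
count-suc n t = trans (∑-words-suc n (λ w → δ (state w) t))
  (cong₂ _+_ (∑-cong (words n) (λ w → cong (λ s → δ s t) (state-∷ʳ w U)))
             (∑-cong (words n) (λ w → cong (λ s → δ s t) (state-∷ʳ w D))))

numberOfLength : ∀ {P : List Step → Set} n {t c} → (∀ w → P w ⇔ state w ≡ t) → + count n t ≡ c → NumberOfLength P n c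
numberOfLength n {t} P⇔t count≡c = count n t , CountP-∑ (λ w → state w ≟ˢ t) P⇔t (words n) , count≡c

step-U-≢-up0 : ∀ s → step s U ≢ up 0
step-U-≢-up0 dead       ()
step-U-≢-up0 (up _)     ()
step-U-≢-up0 (down _ _) ()

step-U-≢-down : ∀ s {j q} → step s U ≢ down j q
step-U-≢-down dead       ()
step-U-≢-down (up _)     ()
step-U-≢-down (down _ _) ()

descend-≢-up : ∀ k q {j} → descend k q ≢ up j
descend-≢-up zero             _  ()
descend-≢-up (suc zero)       0ℙ ()
descend-≢-up (suc zero)       1ℙ ()
descend-≢-up (suc (suc _))    _  ()

step-D-≢-up : ∀ s {j} → step s D ≢ up j
step-D-≢-up dead       ()
step-D-≢-up (up k)     = descend-≢-up k 0ℙ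
step-D-≢-up (down k q) = descend-≢-up k q

descend-≢-down00 : ∀ k q → descend k q ≢ down 0 0ℙ
descend-≢-down00 zero             _  ()
descend-≢-down00 (suc zero)       0ℙ ()
descend-≢-down00 (suc zero)       1ℙ ()
descend-≢-down00 (suc (suc _))    _  ()

step-D-≢-down00 : ∀ s → step s D ≢ down 0 0ℙ
step-D-≢-down00 dead       ()
step-D-≢-down00 (up k)     = descend-≢-down00 k 0ℙ
step-D-≢-down00 (down k q) = descend-≢-down00 k q

δ-step-U-up : ∀ j s → δ (step s U) (up (suc j)) ≡ δ s (up j) + δ s (down j 0ℙ) + δ s (down j 1ℙ)
δ-step-U-up j dead        = refl
δ-step-U-up j (up k)      = sym (trans (+-identityʳ _) (+-identityʳ _))
δ-step-U-up j (down k 0ℙ) = sym (+-identityʳ _)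
δ-step-U-up j (down k 1ℙ) = refl

δ-step-D-down1 : ∀ j s → δ (step s D) (down j 1ℙ) ≡ δ s (up (suc j)) + δ s (down (suc j) 0ℙ)
δ-step-D-down1 j dead                    = refl
δ-step-D-down1 j (up zero)               = refl
δ-step-D-down1 j (up (suc zero))         = sym (+-identityʳ _)
δ-step-D-down1 j (up (suc (suc k)))      = sym (+-identityʳ _)
δ-step-D-down1 j (down zero 0ℙ)          = refl
δ-step-D-down1 j (down zero 1ℙ)          = refl
δ-step-D-down1 j (down (suc zero) 0ℙ)    = refl
δ-step-D-down1 j (down (suc zero) 1ℙ)    = refl
δ-step-D-down1 j (down (suc (suc k)) 0ℙ) = refl
δ-step-D-down1 j (down (suc (suc k)) 1ℙ) = refl

δ-step-D-down0 : ∀ j s → δ (step s D) (down (suc j) 0ℙ) ≡ δ s (down (suc (suc j)) 1ℙ)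
δ-step-D-down0 j dead                    = refl
δ-step-D-down0 j (up zero)               = refl
δ-step-D-down0 j (up (suc zero))         = refl
δ-step-D-down0 j (up (suc (suc k)))      = refl
δ-step-D-down0 j (down zero 0ℙ)          = refl
δ-step-D-down0 j (down zero 1ℙ)          = refl
δ-step-D-down0 j (down (suc zero) 0ℙ)    = refl
δ-step-D-down0 j (down (suc zero) 1ℙ)    = refl
δ-step-D-down0 j (down (suc (suc k)) 0ℙ) = refl
δ-step-D-down0 j (down (suc (suc k)) 1ℙ) = refl

∑-δ-≢ : ∀ n (f : State → State) {t} → (∀ s → f s ≢ t) → ∑ (λ w → δ (f (state w)) t) (words n) ≡ 0
∑-δ-≢ n f f≢t = trans (∑-cong (words n) (λ w → δ-≢ (f≢t (state w)))) (∑-0 (words n))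

count-suc-up0 : ∀ n → count (suc n) (up 0) ≡ 0
count-suc-up0 n = trans (count-suc n (up 0)) (cong₂ _+_ (∑-δ-≢ n (λ s → step s U) step-U-≢-up0) (∑-δ-≢ n (λ s → step s D) (λ s → step-D-≢-up s)))

count-suc-up : ∀ n j → count (suc n) (up (suc j)) ≡ count n (up j) + count n (down j 0ℙ) + count n (down j 1ℙ)
count-suc-up n j = begin
  count (suc n) (up (suc j))
    ≡⟨ count-suc n (up (suc j)) ⟩
  ∑ (λ w → δ (step (state w) U) (up (suc j))) ws + ∑ (λ w → δ (step (state w) D) (up (suc j))) ws
    ≡⟨ cong₂ _+_ (∑-cong ws (λ w → δ-step-U-up j (state w))) (∑-δ-≢ n (λ s → step s D) (λ s → step-D-≢-up s)) ⟩
  ∑ (λ w → δ (state w) (up j) + δ (state w) (down j 0ℙ) + δ (state w) (down j 1ℙ)) ws + 0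
    ≡⟨ +-identityʳ _ ⟩
  ∑ (λ w → δ (state w) (up j) + δ (state w) (down j 0ℙ) + δ (state w) (down j 1ℙ)) ws
    ≡⟨ ∑-+ (λ w → δ (state w) (up j) + δ (state w) (down j 0ℙ)) (λ w → δ (state w) (down j 1ℙ)) ws ⟩
  ∑ (λ w → δ (state w) (up j) + δ (state w) (down j 0ℙ)) ws + count n (down j 1ℙ)
    ≡⟨ cong (_+ count n (down j 1ℙ)) (∑-+ (λ w → δ (state w) (up j)) (λ w → δ (state w) (down j 0ℙ)) ws) ⟩
  count n (up j) + count n (down j 0ℙ) + count n (down j 1ℙ)  ∎
  where
  open ≡-Reasoning
  ws = words n

count-suc-down1 : ∀ n j → count (suc n) (down j 1ℙ) ≡ count n (up (suc j)) + count n (down (suc j) 0ℙ)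
count-suc-down1 n j = begin
  count (suc n) (down j 1ℙ)
    ≡⟨ count-suc n (down j 1ℙ) ⟩
  ∑ (λ w → δ (step (state w) U) (down j 1ℙ)) ws + ∑ (λ w → δ (step (state w) D) (down j 1ℙ)) ws
    ≡⟨ cong₂ _+_ (∑-δ-≢ n (λ s → step s U) (λ s → step-U-≢-down s)) (∑-cong ws (λ w → δ-step-D-down1 j (state w))) ⟩
  0 + ∑ (λ w → δ (state w) (up (suc j)) + δ (state w) (down (suc j) 0ℙ)) ws
    ≡⟨ ∑-+ (λ w → δ (state w) (up (suc j))) (λ w → δ (state w) (down (suc j) 0ℙ)) ws ⟩
  count n (up (suc j)) + count n (down (suc j) 0ℙ)  ∎
  where
  open ≡-Reasoning
  ws = words n

count-suc-down0 : ∀ n j → count (suc n) (down (suc j) 0ℙ) ≡ count n (down (2 + j) 1ℙ)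
count-suc-down0 n j = trans (count-suc n (down (suc j) 0ℙ))
  (cong₂ _+_ (∑-δ-≢ n (λ s → step s U) (λ s → step-U-≢-down s)) (∑-cong (words n) (λ w → δ-step-D-down0 j (state w))))

count-down00 : ∀ n → count n (down 0 0ℙ) ≡ 0
count-down00 zero    = refl
count-down00 (suc n) = trans (count-suc n (down 0 0ℙ))
  (cong₂ _+_ (∑-δ-≢ n (λ s → step s U) (λ s → step-U-≢-down s)) (∑-δ-≢ n (λ s → step s D) step-D-≢-down00))

shift : ℕ → (ℕ → ℕ) → ℕ → ℕ
shift zero    a n       = a n
shift (suc k) a zero    = 0
shift (suc k) a (suc n) = shift k a n

zMul-shift : ∀ k {s : Series} {a : ℕ → ℕ} → (∀ m → s m ≡ + a m) → ∀ n → zMul k s n ≡ + shift k a n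
zMul-shift zero    s≗a n       = s≗a n
zMul-shift (suc k) s≗a zero    = refl
zMul-shift (suc k) s≗a (suc n) = zMul-shift k s≗a n

-- g_{j+1} = r₂^(j+1) - z² r₂^(j+3) = z r₂^j + z² r₂^(j+1), using r₂ = z + z r₂².
upClosedForm : ℕ → ℕ → ℕ
upClosedForm zero    n = firstPassage 0 n
upClosedForm (suc j) n = shift 1 (firstPassage j) n + shift 2 (firstPassage (suc j)) n

upClosedForm+shift₂≡firstPassage : ∀ j n → upClosedForm (suc j) n + shift 2 (firstPassage (3 + j)) n ≡ firstPassage (suc j) n
upClosedForm+shift₂≡firstPassage j zero          = refl
upClosedForm+shift₂≡firstPassage j (suc zero)    = +-identityʳ _
upClosedForm+shift₂≡firstPassage j (suc (suc m)) = +-assoc (firstPassage j (suc m)) (firstPassage (suc j) m) (firstPassage (3 + j) m)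

count≡closedForms : ∀ n → (∀ j → count n (up j) ≡ upClosedForm j n)
                        × (∀ j → count n (down j 1ℙ) ≡ shift 1 (firstPassage (suc j)) n)
                        × (∀ j → count n (down (suc j) 0ℙ) ≡ shift 2 (firstPassage (3 + j)) n)
count≡closedForms zero = (λ { zero → refl ; (suc _) → refl }) , (λ _ → refl) , (λ _ → refl)
count≡closedForms (suc n) with count≡closedForms n
... | count-up , count-down1 , count-down0 = count-up′ , count-down1′ , count-down0′
  where
  count-up′ : ∀ j → count (suc n) (up j) ≡ upClosedForm j (suc n)
  count-up′ zero          = count-suc-up0 n
  count-up′ (suc zero)    = trans (count-suc-up n 0)
    (cong₂ _+_ (trans (cong₂ _+_ (count-up 0) (count-down00 n)) (+-identityʳ _)) (count-down1 0))
  count-up′ (suc (suc j)) = trans (count-suc-up n (suc j))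
    (cong₂ _+_ (trans (cong₂ _+_ (count-up (suc j)) (count-down0 j)) (upClosedForm+shift₂≡firstPassage j n)) (count-down1 (suc j)))
  count-down1′ : ∀ j → count (suc n) (down j 1ℙ) ≡ firstPassage (suc j) n
  count-down1′ j = trans (count-suc-down1 n j)
    (trans (cong₂ _+_ (count-up (suc j)) (count-down0 j)) (upClosedForm+shift₂≡firstPassage j n))
  count-down0′ : ∀ j → count (suc n) (down (suc j) 0ℙ) ≡ shift 1 (firstPassage (3 + j)) n
  count-down0′ j = trans (count-suc-down0 n j) (count-down1 (2 + j))

+[m+n]-+n≡+m : ∀ m n → + (m + n) ℤ.- + n ≡ + m
+[m+n]-+n≡+m m n = trans (ℤ.[+m]-[+n]≡m⊖n (m + n) n) (trans (ℤ.≤-⊖ (m≤n+m n m)) (cong +_ (m+n∸n≡m m n)))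

count-up0-series : ∀ n → + count n (up 0) ≡ one n
count-up0-series n = trans (cong +_ (proj₁ (count≡closedForms n) 0)) (sym (pow-r₂ 0 n))

count-up-series : ∀ n j → 1 ≤ j → + count n (up j) ≡ (pow r₂ j ⊝ zMul 2 (pow r₂ (j + 2))) n
count-up-series n (suc j) _ = begin
  + count n (up (suc j))
    ≡⟨ cong +_ (proj₁ (count≡closedForms n) (suc j)) ⟩
  + upClosedForm (suc j) n
    ≡⟨ +[m+n]-+n≡+m (upClosedForm (suc j) n) z²r₂^[j+3] ⟨
  + (upClosedForm (suc j) n + z²r₂^[j+3]) ℤ.- + z²r₂^[j+3]
    ≡⟨ cong (λ x → + x ℤ.- + z²r₂^[j+3]) (upClosedForm+shift₂≡firstPassage j n) ⟩
  + firstPassage (suc j) n ℤ.- + z²r₂^[j+3]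
    ≡⟨ cong₂ ℤ._-_ (pow-r₂ (suc j) n) (zMul-shift 2 (pow-r₂-+2 (suc j)) n) ⟨
  pow r₂ (suc j) n ℤ.- zMul 2 (pow r₂ (suc j + 2)) n  ∎
  where
  open ≡-Reasoning
  z²r₂^[j+3] = shift 2 (firstPassage (3 + j)) n

count-oddRun-series : ∀ n j → + count n (down j 1ℙ) ≡ zMul 1 (pow r₂ (suc j)) n
count-oddRun-series n j = trans (cong +_ (proj₁ (proj₂ (count≡closedForms n)) j)) (sym (zMul-shift 1 (pow-r₂ (suc j)) n))

count-evenRun-series : ∀ n j → 1 ≤ j → + count n (down j 0ℙ) ≡ zMul 2 (pow r₂ (j + 2)) n
count-evenRun-series n (suc j) _ = trans (cong +_ (proj₂ (proj₂ (count≡closedForms n)) j)) (sym (zMul-shift 2 (pow-r₂-+2 (suc j)) n))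

Odd⇒1≤ : ∀ {j} → Odd j → 1 ≤ j
Odd⇒1≤ (_ , refl) = s≤s z≤n

mainTheorem1 :
    (∀ n → NumberOfLength (GClass 0) n (one n)) ×
    (∀ j n → 1 ≤ j → NumberOfLength (GClass j) n ((pow r₂ j ⊝ zMul 2 (pow r₂ (j + 2))) n)) ×
    (∀ j n → 1 ≤ j → Odd j → NumberOfLength (FClass j) n (zMul 1 (pow r₂ (suc j)) n)) ×
    (∀ j n → 1 ≤ j → Even j → NumberOfLength (FClass j) n (zMul 2 (pow r₂ (j + 2)) n)) ×
    (∀ j n → Even j → NumberOfLength (HClass j) n (zMul 1 (pow r₂ (suc j)) n)) ×
    (∀ j n → Odd j → NumberOfLength (HClass j) n (zMul 2 (pow r₂ (j + 2)) n))
mainTheorem1 =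
  (λ n → numberOfLength n (GClass⇔state 0) (count-up0-series n)) ,
  (λ j n 1≤j → numberOfLength n (GClass⇔state j) (count-up-series n j 1≤j)) ,
  (λ j n _ odd → numberOfLength n (FClass⇔state j)
    (trans (cong (λ q → + count n (down j q)) (Odd⇒parity≡1ℙ odd)) (count-oddRun-series n j))) ,
  (λ j n 1≤j even → numberOfLength n (FClass⇔state j)
    (trans (cong (λ q → + count n (down j q)) (Even⇒parity≡0ℙ even)) (count-evenRun-series n j 1≤j))) ,
  (λ j n even → numberOfLength n (HClass⇔state j)
    (trans (cong (λ q → + count n (down j (q ⁻¹))) (Even⇒parity≡0ℙ even)) (count-oddRun-series n j))) ,
  (λ j n odd → numberOfLength n (HClass⇔state j)
    (trans (cong (λ q → + count n (down j (q ⁻¹))) (Odd⇒parity≡1ℙ odd)) (count-evenRun-series n j (Odd⇒1≤ odd))))
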